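{- Let $F$ be a field and let $A_1,\ldots,A_m$ ($m \ge 1$) be square matrices over $F$, each of which is strong nondegenerate. Then the Kronecker (tensor) product $A_1 \otimes A_2 \otimes \cdots \otimes A_m$ is weak nondegenerate.
   Context: An $n\times n$ matrix $A$ over $F$ is strong nondegenerate if for every $1 \le t \le n$ and all row indices $1 \le i_1 < \cdots < i_t \le n$, the $t\times t$ submatrix of $A$ formed by rows $i_1,\ldots,i_t$ and columns $1,\ldots,t$ has rank $t$. An $n\times n$ matrix $A$ over $F$ is weak nondegenerate if for every $1 \le t \le n$, every integer $a$, and every integer $q$ coprime to $n$, the $t \times t$ submatrix of $A$ formed by rows $a, a+q, \ldots, a+(t-1)q$ (row indices taken modulo $n$, i.e. rows indexed by $\mathbb{Z}/n\mathbb{Z}$) and columns $1,\ldots,t$ has rank $t$. -}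

module Defs where

open import Level using (Level; _⊔_; suc)
open import Algebra.Bundles using (CommutativeRing)
open import Data.Nat as ℕ using (ℕ; _≤_; _<_; NonZero)
open import Data.Nat.Properties using (≤-trans)
open import Data.Integer as ℤ using (ℤ; +_)
open import Data.Integer.DivMod using (_%ℕ_; n%ℕd<d)
open import Data.Integer.Coprimality using (Coprime)
open import Data.Fin using (Fin; toℕ; fromℕ<; inject≤; combine)
open import Data.Product using (∃; _×_; Σ; _,_; proj₁; proj₂)
open import Data.List.NonEmpty using (List⁺; foldr₁; map)
open import Relation.Nullary using (¬_)
import Algebra.Properties.Monoid.Sum as MonoidSum

record Field (c ℓ : Level) : Set (suc (c ⊔ ℓ)) where
  field
    commutativeRing : CommutativeRing c ℓ
  open CommutativeRing commutativeRing public
  field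
    0≉1     : ¬ (0# ≈ 1#)
    inverse : ∀ x → ¬ (x ≈ 0#) → ∃ λ y → x * y ≈ 1#

module _ {c ℓ : Level} (F : Field c ℓ) where
  open Field F
  open MonoidSum +-monoid using (sum)

  Matrix : ℕ → ℕ → Set c
  Matrix m n = Fin m → Fin n → Carrier

  -- A t × t matrix has rank t iff its t columns are linearly independent
  -- over F.
  HasFullRank : (t : ℕ) → Matrix t t → Set (c ⊔ ℓ)
  HasFullRank t M =
    (v : Fin t → Carrier) →
    (∀ i → sum (λ j → M i j * v j) ≈ 0#) →
    ∀ j → v j ≈ 0#

  StrongNondegenerate : (n : ℕ) → Matrix n n → Set (c ⊔ ℓ)
  StrongNondegenerate n A =
    (t : ℕ) → 1 ≤ t → (t≤n : t ≤ n) →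
    (rows : Fin t → Fin n) →
    (∀ (k l : Fin t) → toℕ k < toℕ l → toℕ (rows k) < toℕ (rows l)) →
    HasFullRank t (λ k j → A (rows k) (inject≤ j t≤n))

  rowMod : (n : ℕ) .{{_ : NonZero n}} → ℤ → ℤ → ℕ → Fin n
  rowMod n a q k = fromℕ< (n%ℕd<d (a ℤ.+ (+ k) ℤ.* q) n)

  WeakNondegenerate : (n : ℕ) → Matrix n n → Set (c ⊔ ℓ)
  WeakNondegenerate n A =
    (t : ℕ) → (1≤t : 1 ≤ t) → (t≤n : t ≤ n) →
    (a q : ℤ) → Coprime q (+ n) →
    let instance _ = ℕ.>-nonZero (≤-trans 1≤t t≤n) in
    HasFullRank t (λ k j → A (rowMod n a q (toℕ k)) (inject≤ j t≤n))

  SqMatrix : Set c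
  SqMatrix = Σ ℕ (λ n → Matrix n n)

  -- Kronecker product (A ⊗ B)[(i,k),(j,l)] = A[i,j] · B[k,l], with the standard
  -- index ordering (i,k) ↦ i · size(B) + k (Data.Fin.combine).
  _⊗_ : SqMatrix → SqMatrix → SqMatrix
  (m , A) ⊗ (n , B) = (m ℕ.* n) , λ r s → kron r s
    where
    open import Data.Fin using (remQuot)
    kron : Fin (m ℕ.* n) → Fin (m ℕ.* n) → Carrier
    kron r s with remQuot n r | remQuot n s
    ... | (i , k) | (j , l) = A i j * B k l

  -- A₁ ⊗ A₂ ⊗ ⋯ ⊗ A_m for a nonempty list (right-nested; ⊗ is associative)
  kronAll : List⁺ SqMatrix → SqMatrix
  kronAll = foldr₁ _⊗_

-- For q coprime to n the rows a, a + q, …, a + (t − 1)q are distinct mod n, so after sorting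
-- them strong nondegeneracy applies: strong implies weak.  It remains to show that weak
-- nondegeneracy passes from A (m × m) and B (n × n) to A ⊗ B.  Row n·i + k of A ⊗ B applied to
-- v is row i of A applied to j ↦ (B vⱼ)ₖ, vⱼ being the j-th length-n block of v; and the
-- (k + s·n)-th term of the progression mod mn has the digits (s-th term mod m of a progression
-- with the same step q, k-th term mod n).  Let t = u·n + w with w < n and let v vanish from
-- index t and be annihilated by the t rows.  For each k < w the rows k + s·n with s ≤ u and weak
-- nondegeneracy of A make row a + kq (mod n) of B vⱼ vanish for every j, and then B kills
-- the block v_u.  Repeating this with k < n and s < u kills all remaining blocks.

module Submission where

open import Defs
open import Level using (Level; _⊔_)
open import Data.Nat as ℕ using (ℕ; NonZero; z≤n; s≤s)
import Data.Nat.Properties as ℕ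
open import Data.Nat.DivMod using (m<n⇒m%n≡m; m≡m%n+[m/n]*n; m%n<n; m/n*n≤m)
open import Data.Nat.Divisibility as ℕ using (n∣m⇒m%n≡0)
open import Data.Integer as ℤ using (ℤ; +_; _⊖_)
import Data.Integer.Properties as ℤ
open import Data.Integer.DivMod using (_%ℕ_; _/ℕ_; n%ℕd<d; a≡a%ℕn+[a/ℕn]*n)
open import Data.Integer.Divisibility.Signed using (_∣_; divides; ∣⇒∣ᵤ; ∣ᵤ⇒∣; ∣m∣n⇒∣m-n; *-monoʳ-∣)
open import Data.Integer.Coprimality using (Coprime; coprime-divisor)
import Data.Integer.Coprimality as Coprime
open import Data.Integer.Tactic.RingSolver using (solve-∀)
open import Data.Fin as Fin using (Fin; toℕ; inject≤; fromℕ<; combine; _↑ˡ_; _↑ʳ_)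
open import Data.Fin.Properties
  using (toℕ-injective; toℕ-inject≤; toℕ-fromℕ<; toℕ<n; toℕ-combine; remQuot-combine; combine-remQuot;
         pigeonhole; any?; _≟_)
open import Data.List as List using (List; []; _∷_; filter; allFin; length; lookup)
open import Data.List.NonEmpty using (List⁺; _∷_; toList)
open import Data.List.Relation.Unary.All as All using (All; []; _∷_)
open import Data.List.Relation.Unary.AllPairs using (AllPairs; _∷_)
import Data.List.Relation.Unary.AllPairs.Properties as AllPairs
open import Data.List.Relation.Unary.Any as Any using ()
open import Data.List.Relation.Unary.Any.Properties using (lookup-index)
open import Data.List.Membership.Propositional using (_∈_)
open import Data.List.Membership.Propositional.Properties using (∈-filter⁺; ∈-filter⁻; ∈-allFin; ∈-lookup)
open import Data.Product using (∃; _×_; _,_; proj₁; proj₂)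
open import Data.Sum using (inj₁; inj₂; [_,_]′)
open import Data.Empty using (⊥-elim)
open import Function using (id; case_of_)
open import Relation.Nullary using (Dec; yes; no)
open import Relation.Binary.PropositionalEquality as ≡ using (_≡_)
import Relation.Binary.Reasoning.Setoid
import Algebra.Properties.Semiring.Sum as SemiringSum

multiple-below⇒≡0 : ∀ {d x} → d ℕ.∣ x → x ℕ.< d → x ≡ 0
multiple-below⇒≡0 {d@(ℕ.suc _)} {x} d∣x x<d = ≡.trans (≡.sym (m<n⇒m%n≡m x<d)) (n∣m⇒m%n≡0 x d d∣x)

≤-congruent-below⇒≡ : ∀ {d a b} → a ℕ.≤ b → b ℕ.< d → d ℕ.∣ ℤ.∣ a ⊖ b ∣ → a ≡ b
≤-congruent-below⇒≡ {d} {a} {b} a≤b b<d d∣a⊖b = ℕ.≤-antisym a≤b (ℕ.m∸n≡0⇒m≤n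
  (multiple-below⇒≡0 (≡.subst (d ℕ.∣_) (ℤ.∣⊖∣-≤ a≤b) d∣a⊖b) (ℕ.≤-<-trans (ℕ.m∸n≤m b a) b<d)))

congruent-below⇒≡ : ∀ {d a b} → a ℕ.< d → b ℕ.< d → + d ∣ + a ℤ.- + b → a ≡ b
congruent-below⇒≡ {d} {a} {b} a<d b<d d∣a-b =
  [ (λ a≤b → ≤-congruent-below⇒≡ a≤b b<d d∣a⊖b)
  , (λ b≤a → ≡.sym (≤-congruent-below⇒≡ b≤a a<d (≡.subst (d ℕ.∣_) (ℤ.∣m⊖n∣≡∣n⊖m∣ a b) d∣a⊖b)))
  ]′ (ℕ.≤-total a b)
  where
  d∣a⊖b : d ℕ.∣ ℤ.∣ a ⊖ b ∣
  d∣a⊖b = ≡.subst (d ℕ.∣_) (≡.cong ℤ.∣_∣ (ℤ.m-n≡m⊖n a b)) (∣⇒∣ᵤ d∣a-b)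

d∣x-x%ℕd : ∀ x d .{{_ : NonZero d}} → + d ∣ x ℤ.- + (x %ℕ d)
d∣x-x%ℕd x d = divides (x /ℕ d)
  (≡.trans (≡.cong (ℤ._- + (x %ℕ d)) (a≡a%ℕn+[a/ℕn]*n x d)) (cancel (+ (x %ℕ d)) (x /ℕ d) (+ d)))
  where
  cancel : ∀ r X D → (r ℤ.+ X ℤ.* D) ℤ.- r ≡ X ℤ.* D
  cancel = solve-∀

%ℕ-unique : ∀ {x d r} .{{_ : NonZero d}} → r ℕ.< d → + d ∣ x ℤ.- + r → x %ℕ d ≡ r
%ℕ-unique {x} {d} {r} r<d d∣x-r = congruent-below⇒≡ (n%ℕd<d x d) r<d
  (≡.subst (+ d ∣_) (difference-of-differences x (+ r) (+ (x %ℕ d))) (∣m∣n⇒∣m-n d∣x-r (d∣x-x%ℕd x d)))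
  where
  difference-of-differences : ∀ x r R → (x ℤ.- r) ℤ.- (x ℤ.- R) ≡ R ℤ.- r
  difference-of-differences = solve-∀

x%ℕd≡y%ℕd⇒d∣x-y : ∀ {x y d} .{{_ : NonZero d}} → x %ℕ d ≡ y %ℕ d → + d ∣ x ℤ.- y
x%ℕd≡y%ℕd⇒d∣x-y {x} {y} {d} eq = ≡.subst (+ d ∣_) (difference-of-differences x y (+ (x %ℕ d)))
  (∣m∣n⇒∣m-n (d∣x-x%ℕd x d) (≡.subst (λ r → + d ∣ y ℤ.- + r) (≡.sym eq) (d∣x-x%ℕd y d)))
  where
  difference-of-differences : ∀ x y R → (x ℤ.- R) ℤ.- (y ℤ.- R) ≡ x ℤ.- y
  difference-of-differences = solve-∀

progression-%ℕ-injective : ∀ {d} .{{_ : NonZero d}} a {q} → Coprime q (+ d) →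
  ∀ {k l} → k ℕ.< d → l ℕ.< d → (a ℤ.+ + k ℤ.* q) %ℕ d ≡ (a ℤ.+ + l ℤ.* q) %ℕ d → k ≡ l
progression-%ℕ-injective {d} a {q} q⊥d {k} {l} k<d l<d eq = congruent-below⇒≡ k<d l<d
  (∣ᵤ⇒∣ (coprime-divisor (+ d) q _ (Coprime.sym {q} {+ d} q⊥d)
    (∣⇒∣ᵤ (≡.subst (+ d ∣_) (difference-of-terms a (+ k) (+ l) q) (x%ℕd≡y%ℕd⇒d∣x-y {a ℤ.+ + k ℤ.* q} eq)))))
  where
  difference-of-terms : ∀ a k l q → (a ℤ.+ k ℤ.* q) ℤ.- (a ℤ.+ l ℤ.* q) ≡ q ℤ.* (k ℤ.- l)
  difference-of-terms = solve-∀

progression-%ℕ-* : ∀ m n .{{_ : NonZero m}} .{{_ : NonZero n}} .{{_ : NonZero (m ℕ.* n)}} a q k s →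
  let x = a ℤ.+ + k ℤ.* q in
  (a ℤ.+ + (k ℕ.+ s ℕ.* n) ℤ.* q) %ℕ (m ℕ.* n) ≡ n ℕ.* ((x /ℕ n ℤ.+ + s ℤ.* q) %ℕ m) ℕ.+ x %ℕ n
progression-%ℕ-* m n a q k s = %ℕ-unique {a ℤ.+ + (k ℕ.+ s ℕ.* n) ℤ.* q} bound
  (≡.subst₂ _∣_ +n*+m≡+mn (≡.sym difference) n*m∣n*[γ-γm])
  where
  x γ : ℤ
  x = a ℤ.+ + k ℤ.* q
  γ = x /ℕ n ℤ.+ + s ℤ.* q
  γm ρ : ℕ
  γm = γ %ℕ m
  ρ = x %ℕ n

  bound : n ℕ.* γm ℕ.+ ρ ℕ.< m ℕ.* n
  bound = begin-strict
    n ℕ.* γm ℕ.+ ρ <⟨ ℕ.+-monoʳ-< (n ℕ.* γm) (n%ℕd<d x n) ⟩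
    n ℕ.* γm ℕ.+ n ≡⟨ ≡.trans (ℕ.+-comm (n ℕ.* γm) n) (≡.sym (ℕ.*-suc n γm)) ⟩
    n ℕ.* ℕ.suc γm ≤⟨ ℕ.*-monoʳ-≤ n (n%ℕd<d γ m) ⟩
    n ℕ.* m ≡⟨ ℕ.*-comm n m ⟩
    m ℕ.* n ∎
    where open ℕ.≤-Reasoning

  n*m∣n*[γ-γm] : + n ℤ.* + m ∣ + n ℤ.* (γ ℤ.- + γm)
  n*m∣n*[γ-γm] = *-monoʳ-∣ (+ n) (d∣x-x%ℕd γ m)

  +n*+m≡+mn : + n ℤ.* + m ≡ + (m ℕ.* n)
  +n*+m≡+mn = ≡.trans (≡.sym (ℤ.pos-* n m)) (≡.cong +_ (ℕ.*-comm n m))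

  difference : (a ℤ.+ + (k ℕ.+ s ℕ.* n) ℤ.* q) ℤ.- + (n ℕ.* γm ℕ.+ ρ) ≡ + n ℤ.* (γ ℤ.- + γm)
  difference = begin
    (a ℤ.+ + (k ℕ.+ s ℕ.* n) ℤ.* q) ℤ.- + (n ℕ.* γm ℕ.+ ρ)
      ≡⟨ ≡.cong₂ (λ K R → (a ℤ.+ K ℤ.* q) ℤ.- R)
           (≡.trans (ℤ.pos-+ k (s ℕ.* n)) (≡.cong (ℤ._+_ (+ k)) (ℤ.pos-* s n)))
           (≡.trans (ℤ.pos-+ (n ℕ.* γm) ρ) (≡.cong (ℤ._+ + ρ) (ℤ.pos-* n γm))) ⟩
    (a ℤ.+ (+ k ℤ.+ + s ℤ.* + n) ℤ.* q) ℤ.- (+ n ℤ.* + γm ℤ.+ + ρ)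
      ≡⟨ regroup a (+ k) (+ s) (+ n) q (+ γm) (+ ρ) ⟩
    x ℤ.+ + s ℤ.* q ℤ.* + n ℤ.- (+ n ℤ.* + γm ℤ.+ + ρ)
      ≡⟨ ≡.cong (λ y → y ℤ.+ + s ℤ.* q ℤ.* + n ℤ.- (+ n ℤ.* + γm ℤ.+ + ρ)) (a≡a%ℕn+[a/ℕn]*n x n) ⟩
    (+ ρ ℤ.+ x /ℕ n ℤ.* + n) ℤ.+ + s ℤ.* q ℤ.* + n ℤ.- (+ n ℤ.* + γm ℤ.+ + ρ)
      ≡⟨ collect (+ ρ) (x /ℕ n) (+ n) (+ s) q (+ γm) ⟩
    + n ℤ.* (γ ℤ.- + γm) ∎
    where
    open ≡.≡-Reasoning
    regroup : ∀ a k s n q g r → (a ℤ.+ (k ℤ.+ s ℤ.* n) ℤ.* q) ℤ.- (n ℤ.* g ℤ.+ r)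
                                 ≡ (a ℤ.+ k ℤ.* q) ℤ.+ s ℤ.* q ℤ.* n ℤ.- (n ℤ.* g ℤ.+ r)
    regroup = solve-∀
    collect : ∀ r b n s q g →
      (r ℤ.+ b ℤ.* n) ℤ.+ s ℤ.* q ℤ.* n ℤ.- (n ℤ.* g ℤ.+ r) ≡ n ℤ.* ((b ℤ.+ s ℤ.* q) ℤ.- g)
    collect = solve-∀

coprime-*ˡ : ∀ {q} m n → Coprime q (+ (m ℕ.* n)) → Coprime q (+ m)
coprime-*ˡ m n q⊥mn (d∣q , d∣m) = q⊥mn (d∣q , ℕ.∣m⇒∣m*n n d∣m)

coprime-*ʳ : ∀ {q} m n → Coprime q (+ (m ℕ.* n)) → Coprime q (+ n)
coprime-*ʳ m n q⊥mn (d∣q , d∣n) = q⊥mn (d∣q , ℕ.∣n⇒∣m*n m d∣n)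

AllPairs-lookup : ∀ {A : Set} {R : A → A → Set} {xs : List A} → AllPairs R xs →
  ∀ i j → toℕ i ℕ.< toℕ j → R (lookup xs i) (lookup xs j)
AllPairs-lookup (px ∷ _) Fin.zero (Fin.suc j) _ = All.lookup px (∈-lookup j)
AllPairs-lookup (_ ∷ pxs) (Fin.suc i) (Fin.suc j) (ℕ.s≤s i<j) = AllPairs-lookup pxs i j i<j

sort-injection : ∀ {t N} (f : Fin t → Fin N) → (∀ {k l} → f k ≡ f l → k ≡ l) →
  ∃ λ (g : Fin t → Fin N) →
    (∀ k l → toℕ k ℕ.< toℕ l → toℕ (g k) ℕ.< toℕ (g l)) × (∀ k → ∃ λ l → g k ≡ f l)
sort-injection {t} {N} f f-injective = g , g-increasing , g-⊆-f
  where
  inImage? : (s : Fin N) → Dec (∃ λ k → f k ≡ s)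
  inImage? s = any? (λ k → f k ≟ s)

  image : List (Fin N)
  image = filter inImage? (allFin N)

  image-increasing : AllPairs Fin._<_ image
  image-increasing = AllPairs.filter⁺ inImage? (AllPairs.tabulate⁺-< {n = N} id)

  f∈image : ∀ k → f k ∈ image
  f∈image k = ∈-filter⁺ inImage? (∈-allFin (f k)) (k , ≡.refl)

  position : Fin t → Fin (length image)
  position k = Any.index (f∈image k)

  position-injective : ∀ {k l} → position k ≡ position l → k ≡ l
  position-injective {k} {l} eq = f-injective (≡.trans (lookup-index (f∈image k))
    (≡.trans (≡.cong (lookup image) eq) (≡.sym (lookup-index (f∈image l)))))

  t≤|image| : t ℕ.≤ length image
  t≤|image| = ℕ.≮⇒≥ λ |image|<t → case pigeonhole |image|<t position of λ where
    (k , l , k<l , eq) → ℕ.<⇒≢ k<l (≡.cong toℕ (position-injective eq))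

  g : Fin t → Fin N
  g k = lookup image (inject≤ k t≤|image|)

  g-increasing : ∀ k l → toℕ k ℕ.< toℕ l → toℕ (g k) ℕ.< toℕ (g l)
  g-increasing k l k<l =
    AllPairs-lookup image-increasing (inject≤ k t≤|image|) (inject≤ l t≤|image|)
      (≡.subst₂ ℕ._<_ (≡.sym (toℕ-inject≤ k t≤|image|)) (≡.sym (toℕ-inject≤ l t≤|image|)) k<l)

  g-⊆-f : ∀ k → ∃ λ l → g k ≡ f l
  g-⊆-f k with ∈-filter⁻ inImage? {xs = allFin N} (∈-lookup (inject≤ k t≤|image|))
  ... | _ , l , fl≡gk = l , ≡.sym fl≡gk

inject≤-fromℕ< : ∀ {n t} {s : Fin n} (s<t : toℕ s ℕ.< t) (t≤n : t ℕ.≤ n) → inject≤ (fromℕ< s<t) t≤n ≡ s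
inject≤-fromℕ< s<t t≤n = toℕ-injective (≡.trans (toℕ-inject≤ _ t≤n) (toℕ-fromℕ< s<t))

module _ {c ℓ : Level} (F : Field c ℓ) where
  open Field F
  open SemiringSum semiring using (sum; sum-cong-≋; sum-replicate-zero; *-distribˡ-sum)
  private module ≈-Reasoning = Relation.Binary.Reasoning.Setoid setoid

  infix 6 _*ᵥ_

  _*ᵥ_ : ∀ {m n} → Matrix F m n → (Fin n → Carrier) → Fin m → Carrier
  (M *ᵥ v) i = sum (λ j → M i j * v j)

  VanishesFrom : ∀ {n} → ℕ → (Fin n → Carrier) → Set ℓ
  VanishesFrom t v = ∀ s → t ℕ.≤ toℕ s → v s ≈ 0#

  -- HasFullRank of the submatrix on `rows` and the first t columns, phrased for vectors on all
  -- n columns that vanish from index t, so that no submatrix has to be cut out.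
  FullRankOn : ∀ {m n} → Matrix F m n → (t : ℕ) → (Fin t → Fin m) → Set (c ⊔ ℓ)
  FullRankOn M t rows =
    ∀ v → VanishesFrom t v → (∀ k → (M *ᵥ v) (rows k) ≈ 0#) → ∀ s → v s ≈ 0#

  sum-zero : ∀ {n} {f : Fin n → Carrier} → (∀ i → f i ≈ 0#) → sum f ≈ 0#
  sum-zero {n} f≈0 = trans (sum-cong-≋ f≈0) (sum-replicate-zero n)

  sum-↑ : ∀ m {n} (f : Fin (m ℕ.+ n) → Carrier) →
    sum f ≈ sum (λ i → f (i ↑ˡ n)) + sum (λ j → f (m ↑ʳ j))
  sum-↑ ℕ.zero f = sym (+-identityˡ _)
  sum-↑ (ℕ.suc m) f = trans (+-congˡ (sum-↑ m (λ i → f (Fin.suc i)))) (sym (+-assoc _ _ _))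

  sum-combine : ∀ m {n} (f : Fin (m ℕ.* n) → Carrier) →
    sum f ≈ sum (λ i → sum (λ j → f (combine {m} {n} i j)))
  sum-combine ℕ.zero f = refl
  sum-combine (ℕ.suc m) {n} f = trans (sum-↑ n f) (+-congˡ (sum-combine m (λ r → f (n ↑ʳ r))))

  sum-inject≤ : ∀ {n t} (t≤n : t ℕ.≤ n) {f : Fin n → Carrier} → VanishesFrom t f →
    sum f ≈ sum (λ j → f (inject≤ j t≤n))
  sum-inject≤ {t = ℕ.zero} _ f-vanishes = sum-zero (λ s → f-vanishes s z≤n)
  sum-inject≤ {t = ℕ.suc _} (s≤s t≤n) f-vanishes =
    +-congˡ (sum-inject≤ t≤n (λ s t≤s → f-vanishes (Fin.suc s) (s≤s t≤s)))

  *ᵥ-inject≤ : ∀ {m n t} (t≤n : t ℕ.≤ n) (M : Matrix F m n) {v} → VanishesFrom t v →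
    ∀ i → (M *ᵥ v) i ≈ ((λ i j → M i (inject≤ j t≤n)) *ᵥ (λ j → v (inject≤ j t≤n))) i
  *ᵥ-inject≤ t≤n M v-vanishes i =
    sum-inject≤ t≤n (λ s t≤s → trans (*-congˡ (v-vanishes s t≤s)) (zeroʳ _))

  extendByZero : ∀ {t} n → (Fin t → Carrier) → Fin n → Carrier
  extendByZero {t} n u s with toℕ s ℕ.<? t
  ... | yes s<t = u (fromℕ< s<t)
  ... | no _ = 0#

  extendByZero-vanishes : ∀ {t} n (u : Fin t → Carrier) → VanishesFrom {n} t (extendByZero n u)
  extendByZero-vanishes {t} n u s t≤s with toℕ s ℕ.<? t
  ... | yes s<t = ⊥-elim (ℕ.<⇒≱ s<t t≤s)
  ... | no _ = refl

  extendByZero-inject≤ : ∀ {n t} (t≤n : t ℕ.≤ n) u j → extendByZero n u (inject≤ j t≤n) ≈ u j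
  extendByZero-inject≤ {t = t} t≤n u j with toℕ (inject≤ j t≤n) ℕ.<? t
  ... | yes j<t = reflexive (≡.cong u (toℕ-injective (≡.trans (toℕ-fromℕ< j<t) (toℕ-inject≤ j t≤n))))
  ... | no j≮t = ⊥-elim (j≮t (≡.subst (ℕ._< t) (≡.sym (toℕ-inject≤ j t≤n)) (toℕ<n j)))

  module _ {m n t} (M : Matrix F m n) (rows : Fin t → Fin m) (t≤n : t ℕ.≤ n) where

    hasFullRank⇒fullRankOn : HasFullRank F t (λ k j → M (rows k) (inject≤ j t≤n)) → FullRankOn M t rows
    hasFullRank⇒fullRankOn full v v-vanishes killed s with toℕ s ℕ.<? t
    ... | no s≮t = v-vanishes s (ℕ.≮⇒≥ s≮t)
    ... | yes s<t = trans (reflexive (≡.cong v (≡.sym (inject≤-fromℕ< s<t t≤n))))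
      (full (λ j → v (inject≤ j t≤n))
            (λ k → trans (sym (*ᵥ-inject≤ t≤n M v-vanishes (rows k))) (killed k))
            (fromℕ< s<t))

    fullRankOn⇒hasFullRank : FullRankOn M t rows → HasFullRank F t (λ k j → M (rows k) (inject≤ j t≤n))
    fullRankOn⇒hasFullRank full u killed j = begin
      u j                                    ≈⟨ extendByZero-inject≤ t≤n u j ⟨
      extendByZero n u (inject≤ j t≤n)       ≈⟨ full _ (extendByZero-vanishes n u) killed′ (inject≤ j t≤n) ⟩
      0#                                     ∎
      where
      open ≈-Reasoning
      killed′ : ∀ k → (M *ᵥ extendByZero n u) (rows k) ≈ 0#
      killed′ k = trans (*ᵥ-inject≤ t≤n M (extendByZero-vanishes n u) (rows k))
        (trans (sum-cong-≋ (λ j → *-congˡ (extendByZero-inject≤ t≤n u j))) (killed k))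

  fullRankOn-⊆ : ∀ {m n t} {M : Matrix F m n} {rows rows′ : Fin t → Fin m} →
    (∀ k → ∃ λ l → rows′ k ≡ rows l) → FullRankOn M t rows′ → FullRankOn M t rows
  fullRankOn-⊆ {M = M} rows′⊆rows full v v-vanishes killed = full v v-vanishes killed′
    where
    killed′ : ∀ k → (M *ᵥ v) _ ≈ 0#
    killed′ k with rows′⊆rows k
    ... | l , eq = trans (reflexive (≡.cong (M *ᵥ v) eq)) (killed l)

  strong⇒fullRankOn : ∀ {n t} {M : Matrix F n n} → StrongNondegenerate F n M → t ℕ.≤ n →
    (rows : Fin t → Fin n) → (∀ {k l} → rows k ≡ rows l → k ≡ l) → FullRankOn M t rows
  strong⇒fullRankOn {t = ℕ.zero} _ _ _ _ v v-vanishes _ s = v-vanishes s z≤n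
  strong⇒fullRankOn {t = t@(ℕ.suc _)} {M} strong t≤n rows rows-injective
    with sort-injection rows rows-injective
  ... | sorted , sorted-increasing , sorted⊆rows = fullRankOn-⊆ {M = M} sorted⊆rows
    (hasFullRank⇒fullRankOn M sorted t≤n (strong t (s≤s z≤n) t≤n sorted sorted-increasing))

  -- Weak nondegeneracy, extended to t = 0 where it holds trivially; this spares the Kronecker
  -- step the cases w = 0 and u = 0.
  CyclicFullRank : ∀ {n} → Matrix F n n → Set (c ⊔ ℓ)
  CyclicFullRank {n} M = .{{_ : NonZero n}} → ∀ t → t ℕ.≤ n → ∀ a q → Coprime q (+ n) →
    FullRankOn M t (λ k → rowMod F n a q (toℕ k))

  rowMod-injective : ∀ {n} .{{_ : NonZero n}} a {q} → Coprime q (+ n) →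
    ∀ {k l} → k ℕ.< n → l ℕ.< n → rowMod F n a q k ≡ rowMod F n a q l → k ≡ l
  rowMod-injective a q⊥n k<n l<n eq = progression-%ℕ-injective a q⊥n k<n l<n
    (≡.trans (≡.sym (toℕ-fromℕ< _)) (≡.trans (≡.cong toℕ eq) (toℕ-fromℕ< _)))

  strong⇒cyclic : ∀ {n} {M : Matrix F n n} → StrongNondegenerate F n M → CyclicFullRank M
  strong⇒cyclic {n} {M} strong t t≤n a q q⊥n =
    strong⇒fullRankOn {M = M} strong t≤n (λ k → rowMod F n a q (toℕ k)) (λ {k} {l} eq →
      toℕ-injective (rowMod-injective a {q} q⊥n (ℕ.<-≤-trans (toℕ<n k) t≤n) (ℕ.<-≤-trans (toℕ<n l) t≤n) eq))

  cyclic⇒weak : ∀ {n} {M : Matrix F n n} → CyclicFullRank M → WeakNondegenerate F n M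
  cyclic⇒weak {M = M} cyclic t 1≤t t≤n a q q⊥n =
    fullRankOn⇒hasFullRank M _ t≤n (cyclic {{ℕ.>-nonZero (ℕ.≤-trans 1≤t t≤n)}} t t≤n a q q⊥n)

  infixl 7 _⊗ₘ_

  _⊗ₘ_ : ∀ {m n} → Matrix F m m → Matrix F n n → Matrix F (m ℕ.* n) (m ℕ.* n)
  _⊗ₘ_ {m} {n} A B = proj₂ (_⊗_ F (m , A) (n , B))

  ⊗-combine : ∀ {m n} (A : Matrix F m m) (B : Matrix F n n) i k j l →
    (A ⊗ₘ B) (combine i k) (combine j l) ≡ A i j * B k l
  ⊗-combine {m} {n} A B i k j l = ≡.cong₂ (λ x y → A (proj₁ x) (proj₁ y) * B (proj₂ x) (proj₂ y))
    (remQuot-combine {m} {n} i k) (remQuot-combine {m} {n} j l)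

  ⊗-*ᵥ-combine : ∀ {m n} (A : Matrix F m m) (B : Matrix F n n) v i k →
    (A ⊗ₘ B *ᵥ v) (combine i k) ≈ (A *ᵥ (λ j → (B *ᵥ (λ l → v (combine j l))) k)) i
  ⊗-*ᵥ-combine {m} {n} A B v i k = begin
    (A ⊗ₘ B *ᵥ v) (combine i k)
      ≈⟨ sum-combine m {n} _ ⟩
    sum (λ j → sum (λ l → (A ⊗ₘ B) (combine i k) (combine j l) * slice j l))
      ≈⟨ sum-cong-≋ (λ j → sum-cong-≋ (λ l → *-congʳ (reflexive (⊗-combine A B i k j l)))) ⟩
    sum (λ j → sum (λ l → A i j * B k l * slice j l))
      ≈⟨ sum-cong-≋ (λ j → trans (sum-cong-≋ (λ l → *-assoc (A i j) (B k l) (slice j l)))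
                                (sym (*-distribˡ-sum (A i j) (λ l → B k l * slice j l)))) ⟩
    (A *ᵥ (λ j → (B *ᵥ slice j) k)) i ∎
    where
    open ≈-Reasoning
    slice : Fin m → Fin n → Carrier
    slice j l = v (combine j l)

  rowMod-combine : ∀ m n .{{_ : NonZero m}} .{{_ : NonZero n}} .{{_ : NonZero (m ℕ.* n)}} a q k s →
    rowMod F (m ℕ.* n) a q (k ℕ.+ s ℕ.* n)
      ≡ combine (rowMod F m ((a ℤ.+ + k ℤ.* q) /ℕ n) q s) (rowMod F n a q k)
  rowMod-combine m n a q k s =
    toℕ-injective (≡.trans (toℕ-fromℕ< _) (≡.trans (progression-%ℕ-* m n a q k s) (≡.sym digits)))
    where
    x : ℤ
    x = a ℤ.+ + k ℤ.* q
    digits : toℕ (combine (rowMod F m (x /ℕ n) q s) (rowMod F n a q k))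
               ≡ n ℕ.* ((x /ℕ n ℤ.+ + s ℤ.* q) %ℕ m) ℕ.+ x %ℕ n
    digits = ≡.trans (toℕ-combine (rowMod F m (x /ℕ n) q s) (rowMod F n a q k))
      (≡.cong₂ (λ i ρ → n ℕ.* i ℕ.+ ρ) (toℕ-fromℕ< _) (toℕ-fromℕ< _))

  module ⊗-Cyclic
    {m n} .{{_ : NonZero m}} .{{_ : NonZero n}} .{{_ : NonZero (m ℕ.* n)}}
    {A : Matrix F m m} {B : Matrix F n n}
    (A-cyclic : CyclicFullRank A) (B-cyclic : CyclicFullRank B)
    {t} (t≤mn : t ℕ.≤ m ℕ.* n) (a q : ℤ) (q⊥m : Coprime q (+ m)) (q⊥n : Coprime q (+ n))
    (v : Fin (m ℕ.* n) → Carrier)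
    (killed : ∀ k → k ℕ.< t → (A ⊗ₘ B *ᵥ v) (rowMod F (m ℕ.* n) a q k) ≈ 0#)
    where

    slice : Fin m → Fin n → Carrier
    slice j l = v (combine j l)

    reduced : Fin n → Fin m → Carrier
    reduced ρ j = (B *ᵥ slice j) ρ

    SlicesVanishFrom : ℕ → Set ℓ
    SlicesVanishFrom u = ∀ j → u ℕ.≤ toℕ j → ∀ l → slice j l ≈ 0#

    reduced-killed : ∀ k s → k ℕ.+ s ℕ.* n ℕ.< t →
      (A *ᵥ reduced (rowMod F n a q k)) (rowMod F m ((a ℤ.+ + k ℤ.* q) /ℕ n) q s) ≈ 0#
    reduced-killed k s k+sn<t = begin
      (A *ᵥ reduced ρ) i
        ≈⟨ ⊗-*ᵥ-combine A B v i ρ ⟨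
      (A ⊗ₘ B *ᵥ v) (combine i ρ)
        ≡⟨ ≡.cong (A ⊗ₘ B *ᵥ v) (rowMod-combine m n a q k s) ⟨
      (A ⊗ₘ B *ᵥ v) (rowMod F (m ℕ.* n) a q (k ℕ.+ s ℕ.* n))
        ≈⟨ killed _ k+sn<t ⟩
      0# ∎
      where
      open ≈-Reasoning
      i : Fin m
      i = rowMod F m ((a ℤ.+ + k ℤ.* q) /ℕ n) q s
      ρ : Fin n
      ρ = rowMod F n a q k

    reduced-zero : ∀ k u → u ℕ.≤ m → (∀ s → s ℕ.< u → k ℕ.+ s ℕ.* n ℕ.< t) → SlicesVanishFrom u →
      ∀ j → reduced (rowMod F n a q k) j ≈ 0#
    reduced-zero k u u≤m in-range vanish = A-cyclic u u≤m ((a ℤ.+ + k ℤ.* q) /ℕ n) q q⊥m (reduced _)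
      (λ j u≤j → sum-zero (λ l → trans (*-congˡ (vanish j u≤j l)) (zeroʳ _)))
      (λ s → reduced-killed k (toℕ s) (in-range (toℕ s) (toℕ<n s)))

    slices-zero : ∀ u → u ℕ.* n ℕ.≤ t → SlicesVanishFrom u → ∀ j l → slice j l ≈ 0#
    slices-zero u un≤t vanish j = B-cyclic n ℕ.≤-refl a q q⊥n (slice j)
      (λ l n≤l → ⊥-elim (ℕ.<⇒≱ (toℕ<n l) n≤l))
      (λ k → reduced-zero (toℕ k) u u≤m (in-range (toℕ<n k)) vanish j)
      where
      u≤m : u ℕ.≤ m
      u≤m = ℕ.*-cancelʳ-≤ u m n (ℕ.≤-trans un≤t t≤mn)
      in-range : ∀ {k} → k ℕ.< n → ∀ s → s ℕ.< u → k ℕ.+ s ℕ.* n ℕ.< t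
      in-range {k} k<n s s<u = ℕ.<-≤-trans (ℕ.+-monoˡ-< (s ℕ.* n) k<n) (ℕ.≤-trans (ℕ.*-monoˡ-≤ n s<u) un≤t)

    u = t ℕ./ n
    w = t ℕ.% n

    t≡w+un : t ≡ w ℕ.+ u ℕ.* n
    t≡w+un = m≡m%n+[m/n]*n t n

    beyond-quotient : ∀ {j : Fin m} → u ℕ.< toℕ j → ∀ (l : Fin n) → t ℕ.≤ toℕ (combine j l)
    beyond-quotient {j} u<j l = begin
      t                        ≡⟨ t≡w+un ⟩
      w ℕ.+ u ℕ.* n            ≤⟨ ℕ.<⇒≤ (ℕ.+-monoˡ-< (u ℕ.* n) (m%n<n t n)) ⟩
      ℕ.suc u ℕ.* n            ≤⟨ ℕ.*-monoˡ-≤ n u<j ⟩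
      toℕ j ℕ.* n              ≡⟨ ℕ.*-comm (toℕ j) n ⟩
      n ℕ.* toℕ j              ≤⟨ ℕ.m≤m+n _ (toℕ l) ⟩
      n ℕ.* toℕ j ℕ.+ toℕ l    ≡⟨ toℕ-combine j l ⟨
      toℕ (combine j l)        ∎
      where open ℕ.≤-Reasoning

    slices-vanish-beyond-quotient : VanishesFrom t v → SlicesVanishFrom (ℕ.suc u)
    slices-vanish-beyond-quotient vanish j u<j l = vanish (combine j l) (beyond-quotient u<j l)

    slices-vanish-from-quotient : VanishesFrom t v → SlicesVanishFrom u
    slices-vanish-from-quotient vanish j u≤j with ℕ.m≤n⇒m<n∨m≡n u≤j
    ... | inj₁ u<j = slices-vanish-beyond-quotient vanish j u<j
    ... | inj₂ u≡j = B-cyclic w (ℕ.<⇒≤ (m%n<n t n)) a q q⊥n (slice j) tail-vanishes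
      (λ k → reduced-zero (toℕ k) (ℕ.suc u) (u<m (toℕ<n k)) (in-range (toℕ<n k))
               (slices-vanish-beyond-quotient vanish) j)
      where
      tail-vanishes : ∀ l → w ℕ.≤ toℕ l → slice j l ≈ 0#
      tail-vanishes l w≤l = vanish (combine j l) (begin
        t                        ≡⟨ t≡w+un ⟩
        w ℕ.+ u ℕ.* n            ≤⟨ ℕ.+-monoˡ-≤ (u ℕ.* n) w≤l ⟩
        toℕ l ℕ.+ u ℕ.* n        ≡⟨ ℕ.+-comm (toℕ l) (u ℕ.* n) ⟩
        u ℕ.* n ℕ.+ toℕ l        ≡⟨ ≡.cong (λ x → x ℕ.* n ℕ.+ toℕ l) u≡j ⟩
        toℕ j ℕ.* n ℕ.+ toℕ l    ≡⟨ ≡.cong (ℕ._+ toℕ l) (ℕ.*-comm (toℕ j) n) ⟩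
        n ℕ.* toℕ j ℕ.+ toℕ l    ≡⟨ toℕ-combine j l ⟨
        toℕ (combine j l)        ∎)
        where open ℕ.≤-Reasoning
      u<m : ∀ {k} → k ℕ.< w → u ℕ.< m
      u<m {k} k<w = ℕ.*-cancelʳ-< n u m (begin-strict
        u ℕ.* n                  <⟨ ℕ.m<n+m (u ℕ.* n) (ℕ.≤-<-trans ℕ.z≤n k<w) ⟩
        w ℕ.+ u ℕ.* n            ≡⟨ t≡w+un ⟨
        t                        ≤⟨ t≤mn ⟩
        m ℕ.* n                  ∎)
        where open ℕ.≤-Reasoning
      in-range : ∀ {k} → k ℕ.< w → ∀ s → s ℕ.< ℕ.suc u → k ℕ.+ s ℕ.* n ℕ.< t
      in-range {k} k<w s s≤u = begin-strict
        k ℕ.+ s ℕ.* n            <⟨ ℕ.+-monoˡ-< (s ℕ.* n) k<w ⟩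
        w ℕ.+ s ℕ.* n            ≤⟨ ℕ.+-monoʳ-≤ w (ℕ.*-monoˡ-≤ n (ℕ.s≤s⁻¹ s≤u)) ⟩
        w ℕ.+ u ℕ.* n            ≡⟨ t≡w+un ⟨
        t                        ∎
        where open ℕ.≤-Reasoning

    vanishes⇒zero : VanishesFrom t v → ∀ s → v s ≈ 0#
    vanishes⇒zero vanish s = trans (reflexive (≡.cong v (≡.sym (combine-remQuot {m} n s))))
      (slices-zero u (m/n*n≤m t n) (slices-vanish-from-quotient vanish) _ _)

  ⊗-cyclic : ∀ {m n} {A : Matrix F m m} {B : Matrix F n n} → CyclicFullRank A → CyclicFullRank B →
    CyclicFullRank (A ⊗ₘ B)
  ⊗-cyclic {m} {n} {A} {B} A-cyclic B-cyclic {{mn≢0}} t t≤mn a q q⊥mn v vanish killed =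
    ⊗-Cyclic.vanishes⇒zero {A = A} {B} A-cyclic B-cyclic t≤mn a q
      (coprime-*ˡ {q} m n q⊥mn) (coprime-*ʳ {q} m n q⊥mn) v killed′ vanish
    where
    instance
      m≢0 : NonZero m
      m≢0 = ℕ.m*n≢0⇒m≢0 m
      n≢0 : NonZero n
      n≢0 = ℕ.m*n≢0⇒n≢0 m
    killed′ : ∀ k → k ℕ.< t → (A ⊗ₘ B *ᵥ v) (rowMod F (m ℕ.* n) a q k) ≈ 0#
    killed′ k k<t = ≡.subst (λ i → (A ⊗ₘ B *ᵥ v) (rowMod F (m ℕ.* n) a q i) ≈ 0#)
      (toℕ-fromℕ< k<t) (killed (fromℕ< k<t))

  kronAll-cyclic : ∀ Ms → All (λ M → StrongNondegenerate F (proj₁ M) (proj₂ M)) (toList Ms) →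
    CyclicFullRank (proj₂ (kronAll F Ms))
  kronAll-cyclic ((_ , A) ∷ []) (strong ∷ []) = strong⇒cyclic {M = A} strong
  kronAll-cyclic ((_ , A) ∷ M ∷ Ms) (strong ∷ strongs) =
    ⊗-cyclic {A = A} {B = proj₂ (kronAll F (M ∷ Ms))}
      (strong⇒cyclic {M = A} strong) (kronAll-cyclic (M ∷ Ms) strongs)

mainTheorem8 : {c ℓ : Level} (F : Field c ℓ) (As : List⁺ (SqMatrix F)) →
    All (λ M → StrongNondegenerate F (proj₁ M) (proj₂ M)) (toList As) →
    WeakNondegenerate F (proj₁ (kronAll F As)) (proj₂ (kronAll F As))
mainTheorem8 F As strong = cyclic⇒weak F {M = proj₂ (kronAll F As)} (kronAll-cyclic F As strong)
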